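{- Let $C(t,p,q)=\sum_{n\ge 0}t^n\sum_{P\in\mathcal{D}_n}p^{\mathrm{run}(P)}q^{\mathrm{ret}(P)}$. Then $$C(t,p,q)=\frac{2pq(1-t)-2(p+q)+4+2(p+q-pq-pqt)\sqrt{1-4t}}{(1-pqt)\left(2-p+p\sqrt{1-4t}\right)\left(2-q+q\sqrt{1-4t}\right)}.$$
   Context: For $n\ge 0$, $\mathcal{D}_n$ is the set of classical Dyck paths of size $n$: lattice paths from $(0,0)$ to $(n,n)$ with unit north steps $N$ and east steps $E$ staying weakly above the line $y=x$ ($\mathcal{D}_0$ consists of the empty path, with $\mathrm{run}=\mathrm{ret}=0$). For $P\in\mathcal{D}_n$ with $n\ge1$, let $u_i$ be the $x$-coordinate of the $i$-th north step of $P$ (bottom to top); $\mathrm{run}(P)=\min\{i\in\{1,\dots,n\}: i\notin\{u_1,\dots,u_n\}\}$ (the number of peaks before the first occurrence of two consecutive east steps), and $\mathrm{ret}(P)$ is the number of north steps of $P$ starting at a point $(i,i)$ on the diagonal, i.e. the number of returns of $P$ to the diagonal. The identity is of formal power series in $t$ (with the branch of $\sqrt{1-4t}$ equal to $1$ at $t=0$). -}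

module Defs where

open import Data.Bool using (Bool; true; false; _∧_; if_then_else_)
open import Data.Nat as ℕ using (ℕ; zero; suc; _≡ᵇ_; _≤ᵇ_; _∸_)
open import Data.List using (List; []; _∷_; _++_; map; filter; length; upTo; concatMap)
open import Data.Bool.ListAction using (any)
open import Data.Integer as ℤ using (ℤ; +_; -_)
open import Relation.Binary.PropositionalEquality using (_≡_)
open import Relation.Nullary.Decidable using (Dec; yes; no)
open import Data.Bool.Properties using () renaming (_≟_ to _≟ᵇ_)

data Step : Set where
  N E : Step

Path : Set
Path = List Step

words : ℕ → List Path
words zero    = [] ∷ []
words (suc m) = concatMap (λ w → (N ∷ w) ∷ (E ∷ w) ∷ []) (words m)

walkOK : ℕ → ℕ → ℕ → Path → Bool
walkOK n x y []       = (x ≡ᵇ n) ∧ (y ≡ᵇ n)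
walkOK n x y (N ∷ ps) = walkOK n x (suc y) ps
walkOK n x y (E ∷ ps) = (suc x ≤ᵇ y) ∧ walkOK n (suc x) y ps

isDyck : ℕ → Path → Bool
isDyck n P = walkOK n 0 0 P

-- 𝒟ₙ : the Dyck paths of size n (each listed exactly once)
dyck : ℕ → List Path
dyck n = filter (λ P → isDyck n P ≟ᵇ true) (words (n ℕ.+ n))

-- x-coordinates u₁, u₂, … of the north steps (bottom to top)
northXs : ℕ → Path → List ℕ
northXs x []       = []
northXs x (N ∷ ps) = x ∷ northXs x ps
northXs x (E ∷ ps) = northXs (suc x) ps

elem : ℕ → List ℕ → Bool
elem i us = any (λ u → u ≡ᵇ i) us

-- least i ∈ {i₀, …, i₀ + fuel} with i ∉ us (0 if none; never happens below)
firstMissing : ℕ → ℕ → List ℕ → ℕ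
firstMissing zero     i us = if elem i us then 0 else i
firstMissing (suc f)  i us = if elem i us then firstMissing f (suc i) us else i

-- run(P) = min { i ∈ {1..n} : i ∉ {u₁..uₙ} } for n ≥ 1, and run = 0 for n = 0
run : ℕ → Path → ℕ
run zero    P = 0
run (suc n) P = firstMissing n 1 (northXs 0 P)

retFrom : ℕ → ℕ → Path → ℕ
retFrom x y []       = 0
retFrom x y (N ∷ ps) = (if x ≡ᵇ y then 1 else 0) ℕ.+ retFrom x (suc y) ps
retFrom x y (E ∷ ps) = retFrom (suc x) y ps

ret : Path → ℕ
ret P = retFrom 0 0 P

-- Formal power series in t, p, q over ℤ (coefficient of tⁿ pᵃ qᵇ)

Series : Set
Series = ℕ → ℕ → ℕ → ℤ

_≈ₛ_ : Series → Series → Set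
f ≈ₛ g = ∀ n a b → f n a b ≡ g n a b

infix 4 _≈ₛ_
infixl 6 _+ₛ_ _-ₛ_
infixl 7 _*ₛ_

_+ₛ_ : Series → Series → Series
(f +ₛ g) n a b = f n a b ℤ.+ g n a b

-ₛ_ : Series → Series
(-ₛ f) n a b = ℤ.- f n a b

_-ₛ_ : Series → Series → Series
f -ₛ g = f +ₛ (-ₛ g)

Σ≤ : ℕ → (ℕ → ℤ) → ℤ
Σ≤ n h = Data.List.foldr ℤ._+_ (+ 0) (map h (upTo (suc n)))

_*ₛ_ : Series → Series → Series
(f *ₛ g) n a b =
  Σ≤ n λ i → Σ≤ a λ j → Σ≤ b λ k → f i j k ℤ.* g (n ∸ i) (a ∸ j) (b ∸ k)

mono : ℤ → ℕ → ℕ → ℕ → Series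
mono c i j k n a b = if (n ≡ᵇ i) ∧ (a ≡ᵇ j) ∧ (b ≡ᵇ k) then c else + 0

const : ℤ → Series
const c = mono c 0 0 0

tₛ pₛ qₛ : Series
tₛ = mono (+ 1) 1 0 0
pₛ = mono (+ 1) 0 1 0
qₛ = mono (+ 1) 0 0 1

C : Series
C n a b = + length (filter (λ P → ((run n P ≡ᵇ a) ∧ (ret P ≡ᵇ b)) ≟ᵇ true) (dyck n))

-- Numerator and denominator of the right-hand side, with S standing for √(1-4t)
numer : Series → Series
numer S =
  const (+ 2) *ₛ pₛ *ₛ qₛ *ₛ (const (+ 1) -ₛ tₛ)
  -ₛ const (+ 2) *ₛ (pₛ +ₛ qₛ)
  +ₛ const (+ 4)
  +ₛ const (+ 2) *ₛ (pₛ +ₛ qₛ -ₛ pₛ *ₛ qₛ -ₛ pₛ *ₛ qₛ *ₛ tₛ) *ₛ S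

denom : Series → Series
denom S =
  (const (+ 1) -ₛ pₛ *ₛ qₛ *ₛ tₛ)
  *ₛ (const (+ 2) -ₛ pₛ +ₛ pₛ *ₛ S)
  *ₛ (const (+ 2) -ₛ qₛ +ₛ qₛ *ₛ S)

module Submission where

-- Cutting a nonempty Dyck path at its first return to the diagonal, P = N A E B, gives
-- ret(P) = 1 + ret(B), while run(P) = 1 + run(B) if A is empty and run(P) = run(A) otherwise.
-- Hence X(a,b) = Σₙ tⁿ Σ_{P ∈ 𝒟ₙ} a^run(P) b^ret(P) satisfies
--   X(a,b) = 1 + t (a b X(a,b) + b (X(a,1) − 1) X(1,b)).
-- At (a,b) = (p,q), (p,1), (1,q), (1,1) these equations express C = X(p,q) through the Catalan series
-- D = X(1,1) = 1 + t D², and the square root of 1 − 4t with constant term 1 is S = 1 − 2tD.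
-- What is left is a polynomial identity: C·denominator − numerator is an explicit combination of the
-- four equations, checked by the ring solver.

open import Defs
open import Data.Integer using (+_)
open import Relation.Binary.PropositionalEquality using (_≡_)

open import Algebra.Bundles using (CommutativeRing; Semiring)
open import Algebra.Structures using (IsCommutativeRing)
open import Algebra.Solver.Ring.AlmostCommutativeRing using (_-Raw-AlmostCommutative⟶_; fromCommutativeRing)
import Algebra.Definitions.RawSemiring as RawSemiring
open import Data.Bool using (Bool; true; false; _∧_; if_then_else_)
open import Data.Bool.Properties using (if-float; if-eta) renaming (_≟_ to _≟ᵇ_)
open import Data.Empty using (⊥-elim)
import Data.Integer as ℤ
open ℤ using (ℤ)
import Data.Integer.Properties as ℤ
open import Data.List using (List; []; _∷_; _++_; foldr; map; applyUpTo; filter; concatMap; length)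
import Data.List.Properties as List
open import Data.Maybe using (Maybe; just; nothing)
open import Data.Nat as ℕ using (ℕ; zero; suc; _∸_; _≡ᵇ_; _<_; s≤s)
open import Data.Nat.Induction using (<-rec)
open import Data.Nat.Properties using (+-suc; m≤m+n)
open import Data.Product using (_,_; uncurry)
open import Data.Sum using ([_,_]′)
open import Function using (_∘_; id)
import Relation.Binary.PropositionalEquality as ≡
open ≡ using (_≢_)
open import Relation.Nullary using (yes; no)

module PowerSeries {c ℓ} (R : CommutativeRing c ℓ) where

  open CommutativeRing R hiding (zero; isCommutativeRing)
  open import Relation.Binary.Reasoning.Setoid setoid
  open import Algebra.Properties.CommutativeSemigroup +-commutativeSemigroup using (interchange)

  Ser : Set c
  Ser = ℕ → Carrier

  infix 4 _≋_
  _≋_ : Ser → Ser → Set ℓ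
  f ≋ g = ∀ n → f n ≈ g n

  -- conv n F = ∑_{i + j = n} F i j
  conv : ℕ → (ℕ → ℕ → Carrier) → Carrier
  conv zero    F = F 0 0
  conv (suc n) F = F 0 (suc n) + conv n (λ i j → F (suc i) j)

  conv-cong : ∀ n {F G : ℕ → ℕ → Carrier} →
              (∀ i j → i ℕ.+ j ≡ n → F i j ≈ G i j) → conv n F ≈ conv n G
  conv-cong zero    F≈G = F≈G 0 0 ≡.refl
  conv-cong (suc n) F≈G =
    +-cong (F≈G 0 (suc n) ≡.refl) (conv-cong n (λ i j i+j≡n → F≈G (suc i) j (≡.cong suc i+j≡n)))

  conv-zero : ∀ n {F : ℕ → ℕ → Carrier} → (∀ i j → i ℕ.+ j ≡ n → F i j ≈ 0#) → conv n F ≈ 0#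
  conv-zero zero    F≈0 = F≈0 0 0 ≡.refl
  conv-zero (suc n) F≈0 = begin
    _ + conv n _ ≈⟨ +-cong (F≈0 0 (suc n) ≡.refl) (conv-zero n (λ i j e → F≈0 (suc i) j (≡.cong suc e))) ⟩
    0# + 0#      ≈⟨ +-identityˡ 0# ⟩
    0#           ∎

  conv-+ : ∀ n (F G : ℕ → ℕ → Carrier) → conv n (λ i j → F i j + G i j) ≈ conv n F + conv n G
  conv-+ zero    F G = refl
  conv-+ (suc n) F G = trans (+-congˡ (conv-+ n _ _)) (interchange _ _ _ _)

  conv-*ˡ : ∀ n a (F : ℕ → ℕ → Carrier) → a * conv n F ≈ conv n (λ i j → a * F i j)
  conv-*ˡ zero    a F = refl
  conv-*ˡ (suc n) a F = trans (distribˡ a _ _) (+-congˡ (conv-*ˡ n a _))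

  conv-*ʳ : ∀ n a (F : ℕ → ℕ → Carrier) → conv n F * a ≈ conv n (λ i j → F i j * a)
  conv-*ʳ zero    a F = refl
  conv-*ʳ (suc n) a F = trans (distribʳ a _ _) (+-congˡ (conv-*ʳ n a _))

  conv-last : ∀ n (F : ℕ → ℕ → Carrier) → conv (suc n) F ≈ conv n (λ i j → F i (suc j)) + F (suc n) 0
  conv-last zero    F = refl
  conv-last (suc n) F = trans (+-congˡ (conv-last n (λ i j → F (suc i) j))) (sym (+-assoc _ _ _))

  conv-first : ∀ n {F : ℕ → ℕ → Carrier} → (∀ i j → F (suc i) j ≈ 0#) → conv n F ≈ F 0 n
  conv-first zero    F≈0 = refl
  conv-first (suc n) F≈0 = trans (+-congˡ (conv-zero n (λ i j _ → F≈0 i j))) (+-identityʳ _)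

  conv-comm : ∀ n (F : ℕ → ℕ → Carrier) → conv n F ≈ conv n (λ i j → F j i)
  conv-comm zero    F = refl
  conv-comm (suc n) F = begin
    F 0 (suc n) + conv n (λ i j → F (suc i) j)   ≈⟨ +-congˡ (conv-comm n _) ⟩
    F 0 (suc n) + conv n (λ i j → F (suc j) i)   ≈⟨ +-comm _ _ ⟩
    conv n (λ i j → F (suc j) i) + F 0 (suc n)   ≈⟨ conv-last n (λ i j → F j i) ⟨
    conv (suc n) (λ i j → F j i)                 ∎

  conv-assoc : ∀ n (F : ℕ → ℕ → ℕ → Carrier) →
               conv n (λ i k → conv i (λ a b → F a b k)) ≈ conv n (λ a i → conv i (λ b k → F a b k))
  conv-assoc zero    F = refl
  conv-assoc (suc n) F = begin
    F 0 0 (suc n) + conv n (λ i k → F 0 (suc i) k + conv i (λ a b → F (suc a) b k))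
      ≈⟨ +-congˡ (conv-+ n _ _) ⟩
    F 0 0 (suc n) + (conv n (λ i k → F 0 (suc i) k) + conv n (λ i k → conv i (λ a b → F (suc a) b k)))
      ≈⟨ +-assoc _ _ _ ⟨
    conv (suc n) (F 0) + conv n (λ i k → conv i (λ a b → F (suc a) b k))
      ≈⟨ +-congˡ (conv-assoc n (λ a → F (suc a))) ⟩
    conv (suc n) (F 0) + conv n (λ a i → conv i (F (suc a)))
      ∎

  -- The terms with i odd vanish, and in the others j = n + n − i is even as well.
  conv-even : ∀ n {F : ℕ → ℕ → Carrier} → (∀ k l → F (suc (k ℕ.+ k)) l ≈ 0#) →
              conv (n ℕ.+ n) F ≈ conv n (λ k l → F (k ℕ.+ k) (l ℕ.+ l))
  conv-even zero    F-odd≈0 = refl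
  conv-even (suc n) {F} F-odd≈0 = begin
    F 0 (suc (n ℕ.+ suc n)) + conv (n ℕ.+ suc n) (λ i j → F (suc i) j)
      ≡⟨ ≡.cong (λ m → F 0 (suc (n ℕ.+ suc n)) + conv m (λ i j → F (suc i) j)) (+-suc n n) ⟩
    F 0 (suc (n ℕ.+ suc n)) + (F 1 (suc (n ℕ.+ n)) + conv (n ℕ.+ n) (λ i j → F (suc (suc i)) j))
      ≈⟨ +-congˡ (+-cong (F-odd≈0 0 _) (conv-even n F-oddOffset≈0)) ⟩
    F 0 (suc (n ℕ.+ suc n)) + (0# + conv n (λ k l → F (suc (suc (k ℕ.+ k))) (l ℕ.+ l)))
      ≈⟨ +-congˡ (trans (+-identityˡ _) (conv-cong n (λ k l _ → reflexive (≡.cong (λ m → F (suc m) (l ℕ.+ l)) (≡.sym (+-suc k k)))))) ⟩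
    conv (suc n) (λ k l → F (k ℕ.+ k) (l ℕ.+ l))
      ∎
    where
    F-oddOffset≈0 : ∀ k l → F (suc (suc (suc (k ℕ.+ k)))) l ≈ 0#
    F-oddOffset≈0 k l = trans (reflexive (≡.cong (λ m → F (suc m) l) (≡.sym (+-suc (suc k) k)))) (F-odd≈0 (suc k) l)

  infixl 6 _⊕_
  infixl 7 _⊛_

  _⊕_ : Ser → Ser → Ser
  (f ⊕ g) n = f n + g n

  ⊝_ : Ser → Ser
  (⊝ f) n = - f n

  𝟘 : Ser
  𝟘 n = 0#

  _⊛_ : Ser → Ser → Ser
  (f ⊛ g) n = conv n (λ i j → f i * g j)

  monomial : ℕ → Carrier → Ser
  monomial zero    a zero    = a
  monomial zero    a (suc n) = 0#
  monomial (suc k) a zero    = 0#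
  monomial (suc k) a (suc n) = monomial k a n

  𝟙 : Ser
  𝟙 = monomial 0 1#

  monomial-cong : ∀ k {a b} → a ≈ b → monomial k a ≋ monomial k b
  monomial-cong zero    a≈b zero    = a≈b
  monomial-cong zero    a≈b (suc n) = refl
  monomial-cong (suc k) a≈b zero    = refl
  monomial-cong (suc k) a≈b (suc n) = monomial-cong k a≈b n

  monomial≡if : ∀ k a n → monomial k a n ≡ (if n ≡ᵇ k then a else 0#)
  monomial≡if zero    a zero    = ≡.refl
  monomial≡if zero    a (suc n) = ≡.refl
  monomial≡if (suc k) a zero    = ≡.refl
  monomial≡if (suc k) a (suc n) = monomial≡if k a n

  monomial₀-⊛ : ∀ a f → monomial 0 a ⊛ f ≋ (λ n → a * f n)
  monomial₀-⊛ a f zero    = refl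
  monomial₀-⊛ a f (suc n) = trans (+-congˡ (conv-zero n (λ i j _ → zeroˡ (f j)))) (+-identityʳ _)

  monomial-suc-⊛-zero : ∀ k a f → (monomial (suc k) a ⊛ f) 0 ≈ 0#
  monomial-suc-⊛-zero k a f = zeroˡ (f 0)

  monomial-suc-⊛-suc : ∀ k a f n → (monomial (suc k) a ⊛ f) (suc n) ≈ (monomial k a ⊛ f) n
  monomial-suc-⊛-suc k a f n = trans (+-congʳ (zeroˡ _)) (+-identityˡ _)

  monomial-* : ∀ k l a b → monomial k a ⊛ monomial l b ≋ monomial (k ℕ.+ l) (a * b)
  monomial-* zero    l a b n       = trans (monomial₀-⊛ a (monomial l b) n) (scale l n)
    where
    scale : ∀ l n → a * monomial l b n ≈ monomial l (a * b) n
    scale zero    zero    = refl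
    scale zero    (suc n) = zeroʳ a
    scale (suc l) zero    = zeroʳ a
    scale (suc l) (suc n) = scale l n
  monomial-* (suc k) l a b zero    = monomial-suc-⊛-zero k a (monomial l b)
  monomial-* (suc k) l a b (suc n) = trans (monomial-suc-⊛-suc k a (monomial l b) n) (monomial-* k l a b n)

  ⊛-cong : ∀ {f f′ g g′} → f ≋ f′ → g ≋ g′ → f ⊛ g ≋ f′ ⊛ g′
  ⊛-cong f≋f′ g≋g′ n = conv-cong n (λ i j _ → *-cong (f≋f′ i) (g≋g′ j))

  ⊛-comm : ∀ f g → f ⊛ g ≋ g ⊛ f
  ⊛-comm f g n = trans (conv-comm n _) (conv-cong n (λ i j _ → *-comm (f j) (g i)))

  ⊛-assoc : ∀ f g h → (f ⊛ g) ⊛ h ≋ f ⊛ (g ⊛ h)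
  ⊛-assoc f g h n = begin
    conv n (λ i k → conv i (λ a b → f a * g b) * h k)      ≈⟨ conv-cong n (λ i k _ → conv-*ʳ i (h k) _) ⟩
    conv n (λ i k → conv i (λ a b → f a * g b * h k))      ≈⟨ conv-assoc n (λ a b k → f a * g b * h k) ⟩
    conv n (λ a i → conv i (λ b k → f a * g b * h k))      ≈⟨ conv-cong n (λ a i _ → conv-cong i (λ b k _ → *-assoc _ _ _)) ⟩
    conv n (λ a i → conv i (λ b k → f a * (g b * h k)))    ≈⟨ conv-cong n (λ a i _ → conv-*ˡ i (f a) _) ⟨
    conv n (λ a i → f a * conv i (λ b k → g b * h k))      ∎

  ⊛-identityˡ : ∀ f → 𝟙 ⊛ f ≋ f
  ⊛-identityˡ f n = trans (monomial₀-⊛ 1# f n) (*-identityˡ (f n))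

  ⊛-distribʳ : ∀ f g h → (g ⊕ h) ⊛ f ≋ g ⊛ f ⊕ h ⊛ f
  ⊛-distribʳ f g h n = trans (conv-cong n (λ i j _ → distribʳ (f j) (g i) (h i))) (conv-+ n _ _)

  isCommutativeRing : IsCommutativeRing _≋_ _⊕_ _⊛_ ⊝_ 𝟘 𝟙
  isCommutativeRing = record
    { isRing = record
      { +-isAbelianGroup = record
        { isGroup = record
          { isMonoid = record
            { isSemigroup = record
              { isMagma = record
                { isEquivalence = record { refl = λ n → refl ; sym = λ f≋g n → sym (f≋g n) ; trans = λ f≋g g≋h n → trans (f≋g n) (g≋h n) }
                ; ∙-cong = λ f≋f′ g≋g′ n → +-cong (f≋f′ n) (g≋g′ n) }
              ; assoc = λ f g h n → +-assoc (f n) (g n) (h n) }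
            ; identity = (λ f n → +-identityˡ (f n)) , (λ f n → +-identityʳ (f n)) }
          ; inverse = (λ f n → -‿inverseˡ (f n)) , (λ f n → -‿inverseʳ (f n))
          ; ⁻¹-cong = λ f≋g n → -‿cong (f≋g n) }
        ; comm = λ f g n → +-comm (f n) (g n) }
      ; *-cong = ⊛-cong
      ; *-assoc = ⊛-assoc
      ; *-identity = ⊛-identityˡ , (λ f n → trans (⊛-comm f 𝟙 n) (⊛-identityˡ f n))
      ; distrib = (λ f g h n → trans (⊛-comm f (g ⊕ h) n) (trans (⊛-distribʳ f g h n) (+-cong (⊛-comm g f n) (⊛-comm h f n))))
                , ⊛-distribʳ }
    ; *-comm = ⊛-comm }

  commutativeRing : CommutativeRing c ℓ
  commutativeRing = record { isCommutativeRing = isCommutativeRing }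

  open import Algebra.Definitions.RawSemiring (Semiring.rawSemiring semiring) using (_^_)

  infixr 8 _⊛^_
  _⊛^_ : Ser → ℕ → Ser
  _⊛^_ = RawSemiring._^_ (Semiring.rawSemiring (CommutativeRing.semiring commutativeRing))

  x : Ser
  x = monomial 1 1#

  x⊛^≋monomial : ∀ j → x ⊛^ j ≋ monomial j 1#
  x⊛^≋monomial zero    n = refl
  x⊛^≋monomial (suc j) n = begin
    (x ⊛ x ⊛^ j) n               ≈⟨ ⊛-cong {x} (λ _ → refl) (x⊛^≋monomial j) n ⟩
    (x ⊛ monomial j 1#) n        ≈⟨ monomial-* 1 j 1# 1# n ⟩
    monomial (suc j) (1# * 1#) n ≈⟨ monomial-cong (suc j) (*-identityˡ 1#) n ⟩
    monomial (suc j) 1# n        ∎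

  monomial₀-⊛^ : ∀ a k → monomial 0 a ⊛^ k ≋ monomial 0 (a ^ k)
  monomial₀-⊛^ a zero    n = refl
  monomial₀-⊛^ a (suc k) n = trans (⊛-cong {monomial 0 a} (λ _ → refl) (monomial₀-⊛^ a k) n) (monomial-* 0 0 a (a ^ k) n)

  x⊛-zero : ∀ f → (x ⊛ f) 0 ≈ 0#
  x⊛-zero = monomial-suc-⊛-zero 0 1#

  x⊛-suc : ∀ f n → (x ⊛ f) (suc n) ≈ f n
  x⊛-suc f n = trans (monomial-suc-⊛-suc 0 1# f n) (⊛-identityˡ f n)

  ≋-constant+x⊛tail : ∀ {f} a g → f 0 ≈ a → (∀ n → f (suc n) ≈ g n) → f ≋ monomial 0 a ⊕ x ⊛ g
  ≋-constant+x⊛tail a g f₀≈a f₊≈g zero    = trans f₀≈a (sym (trans (+-congˡ (x⊛-zero g)) (+-identityʳ a)))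
  ≋-constant+x⊛tail a g f₀≈a f₊≈g (suc n) = trans (f₊≈g n) (sym (trans (+-identityˡ _) (x⊛-suc g n)))

  ⊛-cancelʳ : ∀ {f g} → (∀ a → a * g 0 ≈ 0# → a ≈ 0#) → f ⊛ g ≋ 𝟘 → f ≋ 𝟘
  ⊛-cancelʳ {f} {g} g₀-cancel fg≈0 = <-rec (λ n → f n ≈ 0#) step
    where
    leading : ∀ n → (∀ {i} → i < n → f i ≈ 0#) → (f ⊛ g) n ≈ f n * g 0
    leading zero    _     = refl
    leading (suc n) f<n≈0 = begin
      (f ⊛ g) (suc n)                                     ≈⟨ conv-last n (λ i j → f i * g j) ⟩
      conv n (λ i j → f i * g (suc j)) + f (suc n) * g 0  ≈⟨ +-congʳ (conv-zero n below) ⟩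
      0# + f (suc n) * g 0                                ≈⟨ +-identityˡ _ ⟩
      f (suc n) * g 0                                     ∎
      where
      below : ∀ i j → i ℕ.+ j ≡ n → f i * g (suc j) ≈ 0#
      below i j ≡.refl = trans (*-congʳ (f<n≈0 (s≤s (m≤m+n i j)))) (zeroˡ _)
    step : ∀ n → (∀ {i} → i < n → f i ≈ 0#) → f n ≈ 0#
    step n f<n≈0 = g₀-cancel (f n) (trans (sym (leading n f<n≈0)) (fg≈0 n))

module DyckPaths where

  open import Data.Bool using (_∨_)
  open import Data.Bool.Properties using (T-≡; ∧-idem; ∨-assoc; ∨-identityʳ)
  open import Data.List.Relation.Unary.All as All using (All; []; _∷_)
  open import Data.Nat using (_+_; _<ᵇ_; _≤_)
  open import Data.Nat.Properties
  open import Data.Product using (_×_; map₁)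
  open import Function.Bundles using (Equivalence)
  open import Relation.Binary.PropositionalEquality

  ≡ᵇ-true⇒≡ : ∀ {m n} → (m ≡ᵇ n) ≡ true → m ≡ n
  ≡ᵇ-true⇒≡ {m} {n} eq = ≡ᵇ⇒≡ m n (Equivalence.from T-≡ eq)

  ≢⇒≡ᵇ-false : ∀ {m n} → m ≢ n → (m ≡ᵇ n) ≡ false
  ≢⇒≡ᵇ-false {m} {n} m≢n with m ≡ᵇ n in eq
  ... | false = refl
  ... | true  = ⊥-elim (m≢n (≡ᵇ-true⇒≡ eq))

  ≡ᵇ-comm : ∀ m n → (m ≡ᵇ n) ≡ (n ≡ᵇ m)
  ≡ᵇ-comm zero    zero    = refl
  ≡ᵇ-comm zero    (suc n) = refl
  ≡ᵇ-comm (suc m) zero    = refl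
  ≡ᵇ-comm (suc m) (suc n) = ≡ᵇ-comm m n

  -- h is the current height y − x above the diagonal.
  isDyckFrom : ℕ → Path → Bool
  isDyckFrom h       []      = h ≡ᵇ 0
  isDyckFrom h       (N ∷ w) = isDyckFrom (suc h) w
  isDyckFrom zero    (E ∷ w) = false
  isDyckFrom (suc h) (E ∷ w) = isDyckFrom h w

  norths easts : Path → ℕ
  norths []      = 0
  norths (N ∷ w) = suc (norths w)
  norths (E ∷ w) = norths w
  easts []      = 0
  easts (N ∷ w) = easts w
  easts (E ∷ w) = suc (easts w)

  length≡norths+easts : ∀ w → length w ≡ norths w + easts w
  length≡norths+easts []      = refl
  length≡norths+easts (N ∷ w) = cong suc (length≡norths+easts w)
  length≡norths+easts (E ∷ w) = trans (cong suc (length≡norths+easts w)) (sym (+-suc (norths w) (easts w)))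

  easts≡height+norths : ∀ h w → isDyckFrom h w ≡ true → easts w ≡ h + norths w
  easts≡height+norths h       []      eq = sym (trans (+-identityʳ h) (≡ᵇ-true⇒≡ eq))
  easts≡height+norths h       (N ∷ w) eq = trans (easts≡height+norths (suc h) w eq) (sym (+-suc h (norths w)))
  easts≡height+norths (suc h) (E ∷ w) eq = cong suc (easts≡height+norths h w eq)

  length-dyck : ∀ w → isDyckFrom 0 w ≡ true → length w ≡ norths w + norths w
  length-dyck w eq = trans (length≡norths+easts w) (cong (λ m → norths w + m) (easts≡height+norths 0 w eq))

  walkOK≡isDyckFrom : ∀ n x d w → walkOK n x (d + x) w ≡ (isDyckFrom d w ∧ (d + x + norths w ≡ᵇ n))
  walkOK≡isDyckFrom n x zero    [] = trans (∧-idem (x ≡ᵇ n)) (cong (_≡ᵇ n) (sym (+-identityʳ x)))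
  walkOK≡isDyckFrom n x (suc d) [] with x ≡ᵇ n in eq
  ... | false = refl
  ... | true  = ≢⇒≡ᵇ-false (subst (λ m → suc (d + x) ≢ m) (≡ᵇ-true⇒≡ eq) (m≢1+n+m x ∘ sym))
  walkOK≡isDyckFrom n x d       (N ∷ w) =
    trans (walkOK≡isDyckFrom n x (suc d) w) (cong (λ m → isDyckFrom (suc d) w ∧ (m ≡ᵇ n)) (sym (+-suc (d + x) (norths w))))
  walkOK≡isDyckFrom n x zero    (E ∷ w) = cong (_∧ walkOK n (suc x) x w) (x<ᵇx≡false x)
    where
    x<ᵇx≡false : ∀ x → (x <ᵇ x) ≡ false
    x<ᵇx≡false zero    = refl
    x<ᵇx≡false (suc x) = x<ᵇx≡false x
  walkOK≡isDyckFrom n x (suc d) (E ∷ w)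
    rewrite Equivalence.to T-≡ (<⇒<ᵇ (s≤s (m≤n+m x d))) =
    subst (λ y → walkOK n (suc x) y w ≡ (isDyckFrom d w ∧ (y + norths w ≡ᵇ n))) (+-suc d x) (walkOK≡isDyckFrom n (suc x) d w)

  record Dyck (n : ℕ) (P : Path) : Set where
    field
      fromGround : isDyckFrom 0 P ≡ true
      norths≡    : norths P ≡ n

    easts≡ : easts P ≡ n
    easts≡ = trans (easts≡height+norths 0 P fromGround) norths≡

  isDyck⇒Dyck : ∀ n P → isDyck n P ≡ true → Dyck n P
  isDyck⇒Dyck n P eq
    with isDyckFrom 0 P in fromGround | norths P ≡ᵇ n in sizeOK | trans (sym (walkOK≡isDyckFrom n 0 0 P)) eq
  ... | true  | true  | _  = record { fromGround = fromGround ; norths≡ = ≡ᵇ-true⇒≡ sizeOK }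
  ... | true  | false | ()
  ... | false | _     | ()

  m+m≡n+n⇒m≡n : ∀ {m n} → m + m ≡ n + n → m ≡ n
  m+m≡n+n⇒m≡n {m} {n} eq = trans (n≡⌊n+n/2⌋ m) (trans (cong ℕ.⌊_/2⌋ eq) (sym (n≡⌊n+n/2⌋ n)))

  isDyck≡isDyckFrom : ∀ n P → length P ≡ n + n → isDyck n P ≡ isDyckFrom 0 P
  isDyck≡isDyckFrom n P length≡n+n with isDyckFrom 0 P in fromGround
  ... | false = trans (walkOK≡isDyckFrom n 0 0 P) (cong (_∧ (norths P ≡ᵇ n)) fromGround)
  ... | true  = trans (walkOK≡isDyckFrom n 0 0 P) (trans (cong (_∧ (norths P ≡ᵇ n)) fromGround) (Equivalence.to T-≡ (≡⇒≡ᵇ _ _ norths≡n)))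
    where
    norths≡n : norths P ≡ n
    norths≡n = m+m≡n+n⇒m≡n (trans (sym (length-dyck P fromGround)) length≡n+n)

  m+m≢1+n+n : ∀ m n → m + m ≢ suc (n + n)
  m+m≢1+n+n m n eq = even≢odd m n (trans (cong (λ k → m + k) (+-identityʳ m)) (trans eq (cong (λ k → suc (n + k)) (sym (+-identityʳ n)))))

  oddLength⇒notDyck : ∀ k w → length w ≡ suc (k + k) → isDyckFrom 0 w ≡ false
  oddLength⇒notDyck k w length≡ with isDyckFrom 0 w in fromGround
  ... | false = refl
  ... | true  = ⊥-elim (m+m≢1+n+n (norths w) k (trans (sym (length-dyck w fromGround)) length≡))

  retFrom-++ : ∀ x y A B → retFrom x y (A ++ B) ≡ retFrom x y A + retFrom (x + easts A) (y + norths A) B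
  retFrom-++ x y []      B rewrite +-identityʳ x | +-identityʳ y = refl
  retFrom-++ x y (N ∷ A) B rewrite retFrom-++ x (suc y) A B | +-suc y (norths A) =
    sym (+-assoc (if x ≡ᵇ y then 1 else 0) (retFrom x (suc y) A) _)
  retFrom-++ x y (E ∷ A) B rewrite retFrom-++ (suc x) y A B | +-suc x (easts A) = refl

  retFrom-suc : ∀ x y w → retFrom (suc x) (suc y) w ≡ retFrom x y w
  retFrom-suc x y []      = refl
  retFrom-suc x y (N ∷ w) = cong (λ r → (if x ≡ᵇ y then 1 else 0) + r) (retFrom-suc x (suc y) w)
  retFrom-suc x y (E ∷ w) = retFrom-suc (suc x) y w

  retFrom-diagonal : ∀ k w → retFrom k k w ≡ ret w
  retFrom-diagonal zero    w = refl
  retFrom-diagonal (suc k) w = trans (retFrom-suc k k w) (retFrom-diagonal k w)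

  retFrom-above : ∀ h x A → isDyckFrom h A ≡ true → retFrom x (suc (h + x)) A ≡ 0
  retFrom-above h       x []      _  = refl
  retFrom-above h       x (N ∷ A) eq rewrite ≢⇒≡ᵇ-false (m≢1+n+m x {h}) = retFrom-above (suc h) x A eq
  retFrom-above (suc h) x (E ∷ A) eq rewrite sym (+-suc h x) = retFrom-above h (suc x) A eq

  ret-firstReturn : ∀ {k} A B → Dyck k A → ret (N ∷ A ++ E ∷ B) ≡ suc (ret B)
  ret-firstReturn {k} A B A∈𝒟ₖ = cong suc (begin
    retFrom 0 1 (A ++ E ∷ B)                                      ≡⟨ retFrom-++ 0 1 A (E ∷ B) ⟩
    retFrom 0 1 A + retFrom (suc (easts A)) (suc (norths A)) B    ≡⟨ cong₂ _+_ (retFrom-above 0 0 A fromGround)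
                                                                       (cong₂ (λ x y → retFrom (suc x) (suc y) B) easts≡ norths≡) ⟩
    retFrom (suc k) (suc k) B                                     ≡⟨ retFrom-diagonal (suc k) B ⟩
    ret B                                                         ∎)
    where
    open ≡-Reasoning
    open Dyck A∈𝒟ₖ

  elem-++ : ∀ i xs ys → elem i (xs ++ ys) ≡ (elem i xs ∨ elem i ys)
  elem-++ i []       ys = refl
  elem-++ i (u ∷ xs) ys rewrite elem-++ i xs ys = sym (∨-assoc (u ≡ᵇ i) (elem i xs) (elem i ys))

  elem-map-suc : ∀ i us → elem (suc i) (map suc us) ≡ elem i us
  elem-map-suc i []       = refl
  elem-map-suc i (u ∷ us) = cong ((u ≡ᵇ i) ∨_) (elem-map-suc i us)

  elem-absent : ∀ {i us} → All (_≢ i) us → elem i us ≡ false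
  elem-absent []             = refl
  elem-absent (u≢i ∷ us≢i) rewrite ≢⇒≡ᵇ-false u≢i = elem-absent us≢i

  northXs-++ : ∀ x A B → northXs x (A ++ B) ≡ northXs x A ++ northXs (x + easts A) B
  northXs-++ x []      B rewrite +-identityʳ x = refl
  northXs-++ x (N ∷ A) B = cong (x ∷_) (northXs-++ x A B)
  northXs-++ x (E ∷ A) B rewrite +-suc x (easts A) = northXs-++ (suc x) A B

  northXs-suc : ∀ x B → northXs (suc x) B ≡ map suc (northXs x B)
  northXs-suc x []      = refl
  northXs-suc x (N ∷ B) = cong (suc x ∷_) (northXs-suc x B)
  northXs-suc x (E ∷ B) = northXs-suc (suc x) B

  northXs-≥ : ∀ x B → All (x ≤_) (northXs x B)
  northXs-≥ x []      = []
  northXs-≥ x (N ∷ B) = ≤-refl ∷ northXs-≥ x B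
  northXs-≥ x (E ∷ B) = All.map (≤-trans (n≤1+n x)) (northXs-≥ (suc x) B)

  northXs-< : ∀ h x w → isDyckFrom h w ≡ true → All (_< x + easts w) (northXs x w)
  northXs-< h       x []      eq = []
  northXs-< h       x (N ∷ w) eq = x<x+easts ∷ northXs-< (suc h) x w eq
    where
    x<x+easts : x < x + easts w
    x<x+easts rewrite easts≡height+norths (suc h) w eq | +-suc x (h + norths w) = s≤s (m≤m+n x _)
  northXs-< (suc h) x (E ∷ w) eq rewrite +-suc x (easts w) = northXs-< h (suc x) w eq

  firstMissing-fuel : ∀ {f g} i us → f ≤ g → elem (i + f) us ≡ false → firstMissing g i us ≡ firstMissing f i us
  firstMissing-fuel {zero} {zero}  i us _ _      = refl
  firstMissing-fuel {zero} {suc g} i us _ absent with elem i us | trans (cong (λ m → elem m us) (sym (+-identityʳ i))) absent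
  ... | false | _  = refl
  ... | true  | ()
  firstMissing-fuel {suc f} {suc g} i us (s≤s f≤g) absent with elem i us
  ... | false = refl
  ... | true  = firstMissing-fuel (suc i) us f≤g (trans (cong (λ m → elem m us) (sym (+-suc i f))) absent)

  firstMissing-cong : ∀ f i us vs → (∀ m → i ≤ m → m ≤ i + f → elem m us ≡ elem m vs) →
                      firstMissing f i us ≡ firstMissing f i vs
  firstMissing-cong zero    i us vs agree rewrite agree i ≤-refl (m≤m+n i 0) = refl
  firstMissing-cong (suc f) i us vs agree rewrite agree i ≤-refl (m≤m+n i (suc f)) with elem i vs
  ... | false = refl
  ... | true  = firstMissing-cong f (suc i) us vs
                  (λ m i<m m≤ → agree m (<⇒≤ i<m) (≤-trans m≤ (≤-reflexive (sym (+-suc i f)))))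

  firstMissing-shift : ∀ f i us → elem (i + f) us ≡ false →
                       firstMissing f (suc i) (0 ∷ map suc us) ≡ suc (firstMissing f i us)
  firstMissing-shift zero    i us absent rewrite elem-map-suc i us
    with elem i us | trans (cong (λ m → elem m us) (sym (+-identityʳ i))) absent
  ... | false | _  = refl
  ... | true  | ()
  firstMissing-shift (suc f) i us absent rewrite elem-map-suc i us with elem i us
  ... | false = refl
  ... | true  = firstMissing-shift f (suc i) us (trans (cong (λ m → elem m us) (sym (+-suc i f))) absent)

  firstMissing-from-0 : ∀ {l} B → Dyck l B → firstMissing l 0 (northXs 0 B) ≡ run l B
  firstMissing-from-0 {zero}  B       _ with elem 0 (northXs 0 B)
  ... | false = refl
  ... | true  = refl
  firstMissing-from-0 {suc l} (N ∷ B) _ = refl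
  firstMissing-from-0 {suc l} []      B∈𝒟 with () ← Dyck.norths≡ B∈𝒟
  firstMissing-from-0 {suc l} (E ∷ B) B∈𝒟 with () ← Dyck.fromGround B∈𝒟

  run-NE : ∀ {l} B → Dyck l B → run (suc l) (N ∷ E ∷ B) ≡ suc (run l B)
  run-NE {l} B B∈𝒟 = begin
    firstMissing l 1 (0 ∷ northXs 1 B)              ≡⟨ cong (λ us → firstMissing l 1 (0 ∷ us)) (northXs-suc 0 B) ⟩
    firstMissing l 1 (0 ∷ map suc (northXs 0 B))    ≡⟨ firstMissing-shift l 0 (northXs 0 B) (elem-absent (All.map <⇒≢ x<l)) ⟩
    suc (firstMissing l 0 (northXs 0 B))            ≡⟨ cong suc (firstMissing-from-0 B B∈𝒟) ⟩
    suc (run l B)                                   ∎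
    where
    open ≡-Reasoning
    x<l : All (_< l) (northXs 0 B)
    x<l = subst (λ m → All (_< m) (northXs 0 B)) (Dyck.easts≡ B∈𝒟) (northXs-< 0 0 B (Dyck.fromGround B∈𝒟))

  run-firstReturn : ∀ {k n} A B → Dyck (suc k) A → suc k ≤ n → run (suc n) (N ∷ A ++ E ∷ B) ≡ run (suc k) A
  run-firstReturn {k} {n} A B A∈𝒟 k<n = begin
    firstMissing n 1 (0 ∷ northXs 0 (A ++ E ∷ B))   ≡⟨ cong (λ us → firstMissing n 1 (0 ∷ us)) (northXs-++ 0 A (E ∷ B)) ⟩
    firstMissing n 1 L                              ≡⟨ firstMissing-fuel 1 L (<⇒≤ k<n) 1+k∉L ⟩
    firstMissing k 1 L                              ≡⟨ firstMissing-cong k 1 xsA L agree ⟨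
    firstMissing k 1 xsA                            ∎
    where
    open ≡-Reasoning
    xsA xsB L : List ℕ
    xsA = northXs 0 A
    xsB = northXs (suc (easts A)) B
    L   = 0 ∷ (xsA ++ xsB)
    xA<1+k : All (_< suc k) xsA
    xA<1+k = subst (λ m → All (_< m) xsA) (Dyck.easts≡ A∈𝒟) (northXs-< 0 0 A (Dyck.fromGround A∈𝒟))
    xB-absent : ∀ {m} → m ≤ suc k → elem m xsB ≡ false
    xB-absent {m} m≤1+k = elem-absent (All.map x≢m (northXs-≥ _ B))
      where
      x≢m : ∀ {x} → suc (easts A) ≤ x → x ≢ m
      x≢m 1+eastsA≤x = ≢-sym (<⇒≢ (≤-trans (s≤s m≤1+k) (subst (λ e → suc e ≤ _) (Dyck.easts≡ A∈𝒟) 1+eastsA≤x)))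
    1+k∉L : elem (1 + k) L ≡ false
    1+k∉L = trans (elem-++ (suc k) xsA xsB) (cong₂ _∨_ (elem-absent (All.map <⇒≢ xA<1+k)) (xB-absent ≤-refl))
    agree : ∀ m → 1 ≤ m → m ≤ 1 + k → elem m xsA ≡ elem m L
    agree (suc m) _ m≤1+k = sym (trans (elem-++ (suc m) xsA xsB) (trans (cong (elem (suc m) xsA ∨_) (xB-absent m≤1+k)) (∨-identityʳ _)))

  splitsAtE : Path → List (Path × Path)
  splitsAtE []      = []
  splitsAtE (N ∷ w) = map (map₁ (N ∷_)) (splitsAtE w)
  splitsAtE (E ∷ w) = ([] , w) ∷ map (map₁ (E ∷_)) (splitsAtE w)

open DyckPaths

module DyckSums {c ℓ} (R : CommutativeRing c ℓ) where

  open CommutativeRing R hiding (zero; isCommutativeRing)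
  open PowerSeries R
  open import Algebra.Definitions.RawSemiring (Semiring.rawSemiring semiring) using (_^_)
  open import Algebra.Properties.CommutativeSemigroup +-commutativeSemigroup using (interchange)
  open import Relation.Binary.Reasoning.Setoid setoid

  ∑ : {X : Set} → List X → (X → Carrier) → Carrier
  ∑ []       f = 0#
  ∑ (x ∷ xs) f = f x + ∑ xs f

  [_]_ : Bool → Carrier → Carrier
  [ b ] a = if b then a else 0#

  [_]-cong : ∀ b {u v} → u ≈ v → [ b ] u ≈ [ b ] v
  [ true  ]-cong u≈v = u≈v
  [ false ]-cong u≈v = refl

  ∑-cong : ∀ {X : Set} (xs : List X) {f g : X → Carrier} → (∀ x → f x ≈ g x) → ∑ xs f ≈ ∑ xs g
  ∑-cong []       f≈g = refl
  ∑-cong (x ∷ xs) f≈g = +-cong (f≈g x) (∑-cong xs f≈g)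

  ∑-zero : ∀ {X : Set} (xs : List X) {f : X → Carrier} → (∀ x → f x ≈ 0#) → ∑ xs f ≈ 0#
  ∑-zero []       f≈0 = refl
  ∑-zero (x ∷ xs) f≈0 = trans (+-cong (f≈0 x) (∑-zero xs f≈0)) (+-identityˡ 0#)

  ∑-+ : ∀ {X : Set} (xs : List X) (f g : X → Carrier) → ∑ xs (λ x → f x + g x) ≈ ∑ xs f + ∑ xs g
  ∑-+ []       f g = sym (+-identityˡ 0#)
  ∑-+ (x ∷ xs) f g = trans (+-congˡ (∑-+ xs f g)) (interchange _ _ _ _)

  ∑-*ˡ : ∀ {X : Set} (xs : List X) a (f : X → Carrier) → a * ∑ xs f ≈ ∑ xs (λ x → a * f x)
  ∑-*ˡ []       a f = zeroʳ a
  ∑-*ˡ (x ∷ xs) a f = trans (distribˡ a _ _) (+-congˡ (∑-*ˡ xs a f))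

  ∑-*ʳ : ∀ {X : Set} (xs : List X) a (f : X → Carrier) → ∑ xs f * a ≈ ∑ xs (λ x → f x * a)
  ∑-*ʳ []       a f = zeroˡ a
  ∑-*ʳ (x ∷ xs) a f = trans (distribʳ a _ _) (+-congˡ (∑-*ʳ xs a f))

  ∑-++ : ∀ {X : Set} (xs ys : List X) (f : X → Carrier) → ∑ (xs ++ ys) f ≈ ∑ xs f + ∑ ys f
  ∑-++ []       ys f = sym (+-identityˡ _)
  ∑-++ (x ∷ xs) ys f = trans (+-congˡ (∑-++ xs ys f)) (sym (+-assoc _ _ _))

  ∑-concatMap : ∀ {X Y : Set} (g : X → List Y) (xs : List X) (f : Y → Carrier) →
                ∑ (concatMap g xs) f ≈ ∑ xs (λ x → ∑ (g x) f)
  ∑-concatMap g []       f = refl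
  ∑-concatMap g (x ∷ xs) f = trans (∑-++ (g x) (concatMap g xs) f) (+-congˡ (∑-concatMap g xs f))

  ∑-map : ∀ {X Y : Set} (g : X → Y) (xs : List X) (f : Y → Carrier) → ∑ (map g xs) f ≡ ∑ xs (λ x → f (g x))
  ∑-map g []       f = ≡.refl
  ∑-map g (x ∷ xs) f = ≡.cong (λ s → f (g x) + s) (∑-map g xs f)

  ∑-filter : ∀ {X : Set} (p : X → Bool) (xs : List X) (f : X → Carrier) →
             ∑ (filter (λ x → p x ≟ᵇ true) xs) f ≈ ∑ xs (λ x → [ p x ] f x)
  ∑-filter p []       f = refl
  ∑-filter p (x ∷ xs) f with p x
  ... | true  = +-congˡ (∑-filter p xs f)
  ... | false = trans (∑-filter p xs f) (sym (+-identityˡ _))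

  sumWords : ℕ → (Path → Carrier) → Carrier
  sumWords m f = ∑ (words m) f

  sumWords-suc : ∀ m f → sumWords (suc m) f ≈ sumWords m (λ w → f (N ∷ w) + f (E ∷ w))
  sumWords-suc m f = trans (∑-concatMap _ (words m) f) (∑-cong (words m) (λ w → +-congˡ (+-identityʳ _)))

  sumWords-cong : ∀ m {f g} → (∀ w → length w ≡ m → f w ≈ g w) → sumWords m f ≈ sumWords m g
  sumWords-cong zero    f≈g = +-congʳ (f≈g [] ≡.refl)
  sumWords-cong (suc m) {f} {g} f≈g = begin
    sumWords (suc m) f                             ≈⟨ sumWords-suc m f ⟩
    sumWords m (λ w → f (N ∷ w) + f (E ∷ w))
      ≈⟨ sumWords-cong m (λ w ∣w∣≡m → +-cong (f≈g (N ∷ w) (≡.cong suc ∣w∣≡m)) (f≈g (E ∷ w) (≡.cong suc ∣w∣≡m))) ⟩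
    sumWords m (λ w → g (N ∷ w) + g (E ∷ w))       ≈⟨ sumWords-suc m g ⟨
    sumWords (suc m) g                             ∎

  splitsSum : (Path → Path → Carrier) → Path → Carrier
  splitsSum G w = ∑ (splitsAtE w) (uncurry G)

  sumWords-splitsSum-suc : ∀ m G → sumWords (suc m) (splitsSum G) ≈
    sumWords m (G []) + (sumWords m (splitsSum (G ∘ (N ∷_))) + sumWords m (splitsSum (G ∘ (E ∷_))))
  sumWords-splitsSum-suc m G = begin
    sumWords (suc m) (splitsSum G)
      ≈⟨ sumWords-suc m _ ⟩
    sumWords m (λ w → splitsSum G (N ∷ w) + splitsSum G (E ∷ w))
      ≈⟨ ∑-cong (words m) (λ w → +-cong (reflexive (∑-map _ (splitsAtE w) _)) (+-congˡ (reflexive (∑-map _ (splitsAtE w) _)))) ⟩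
    sumWords m (λ w → splitsSum (G ∘ (N ∷_)) w + (G [] w + splitsSum (G ∘ (E ∷_)) w))
      ≈⟨ ∑-cong (words m) (λ w → trans (sym (+-assoc _ _ _)) (trans (+-congʳ (+-comm _ _)) (+-assoc _ _ _))) ⟩
    sumWords m (λ w → G [] w + (splitsSum (G ∘ (N ∷_)) w + splitsSum (G ∘ (E ∷_)) w))
      ≈⟨ trans (∑-+ (words m) _ _) (+-congˡ (∑-+ (words m) _ _)) ⟩
    sumWords m (G []) + (sumWords m (splitsSum (G ∘ (N ∷_))) + sumWords m (splitsSum (G ∘ (E ∷_))))
      ∎

  sumWords-splitsSum : ∀ m G → sumWords (suc m) (splitsSum G) ≈ conv m (λ k l → sumWords k (λ A → sumWords l (G A)))
  sumWords-splitsSum zero    G = trans (sumWords-splitsSum-suc 0 G)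
    (+-congˡ (trans (+-cong (+-identityʳ 0#) (+-identityʳ 0#)) (+-identityʳ 0#)))
  sumWords-splitsSum (suc m) G = begin
    sumWords (suc (suc m)) (splitsSum G)
      ≈⟨ sumWords-splitsSum-suc (suc m) G ⟩
    sumWords (suc m) (G []) + (sumWords (suc m) (splitsSum (G ∘ (N ∷_))) + sumWords (suc m) (splitsSum (G ∘ (E ∷_))))
      ≈⟨ +-cong (sym (+-identityʳ _)) (+-cong (sumWords-splitsSum m (G ∘ (N ∷_))) (sumWords-splitsSum m (G ∘ (E ∷_)))) ⟩
    (sumWords (suc m) (G []) + 0#) + (conv m (λ k l → sumWords k (λ A → sumWords l (G (N ∷ A))))
                                      + conv m (λ k l → sumWords k (λ A → sumWords l (G (E ∷ A)))))
      ≈⟨ +-congˡ (trans (conv-cong m (λ k l _ → ∑-+ (words k) _ _)) (conv-+ m _ _)) ⟨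
    (sumWords (suc m) (G []) + 0#) + conv m (λ k l → sumWords k (λ A → sumWords l (G (N ∷ A)) + sumWords l (G (E ∷ A))))
      ≈⟨ +-congˡ (conv-cong m (λ k l _ → sumWords-suc k _)) ⟨
    conv (suc m) (λ k l → sumWords k (λ A → sumWords l (G A)))
      ∎

  -- A walk from height j + h + 1 down to 0 splits uniquely as A E B at its first step down to height h;
  -- the offset j is what makes the induction go through.
  firstPassage : ∀ j h w (F : Path → Carrier) →
    [ isDyckFrom (j ℕ.+ suc h) w ] F w ≈ splitsSum (λ A B → [ isDyckFrom j A ] [ isDyckFrom h B ] F (A ++ E ∷ B)) w
  firstPassage j       h []      F rewrite +-suc j h = refl
  firstPassage j       h (N ∷ w) F = trans (firstPassage (suc j) h w (F ∘ (N ∷_))) (reflexive (≡.sym (∑-map _ (splitsAtE w) _)))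
  firstPassage zero    h (E ∷ w) F = sym (trans (+-congˡ (trans (reflexive (∑-map _ (splitsAtE w) _)) (∑-zero (splitsAtE w) (λ _ → refl)))) (+-identityʳ _))
  firstPassage (suc j) h (E ∷ w) F = trans (firstPassage j h w (F ∘ (E ∷_))) (sym (trans (+-identityˡ _) (reflexive (∑-map _ (splitsAtE w) _))))

  sumDyck : ℕ → (Path → Carrier) → Carrier
  sumDyck n g = ∑ (dyck n) g

  sumDyck-cong : ∀ n {g h} → (∀ P → Dyck n P → g P ≈ h P) → sumDyck n g ≈ sumDyck n h
  sumDyck-cong n {g} {h} g≈h = begin
    sumDyck n g                                             ≈⟨ ∑-filter (isDyck n) (words (n ℕ.+ n)) g ⟩
    sumWords (n ℕ.+ n) (λ P → [ isDyck n P ] g P)          ≈⟨ ∑-cong (words (n ℕ.+ n)) on𝒟ₙ ⟩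
    sumWords (n ℕ.+ n) (λ P → [ isDyck n P ] h P)          ≈⟨ ∑-filter (isDyck n) (words (n ℕ.+ n)) h ⟨
    sumDyck n h                                             ∎
    where
    on𝒟ₙ : ∀ P → [ isDyck n P ] g P ≈ [ isDyck n P ] h P
    on𝒟ₙ P with isDyck n P in P∈𝒟ₙ
    ... | true  = g≈h P (isDyck⇒Dyck n P P∈𝒟ₙ)
    ... | false = refl

  sumDyck-sumWords : ∀ n g → sumDyck n g ≈ sumWords (n ℕ.+ n) (λ w → [ isDyckFrom 0 w ] g w)
  sumDyck-sumWords n g = trans (∑-filter (isDyck n) (words (n ℕ.+ n)) g)
    (sumWords-cong (n ℕ.+ n) (λ w ∣w∣≡n+n → reflexive (≡.cong (λ b → [ b ] g w) (isDyck≡isDyckFrom n w ∣w∣≡n+n))))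

  sumWords-odd : ∀ k (f : Path → Carrier) → sumWords (suc (k ℕ.+ k)) (λ w → [ isDyckFrom 0 w ] f w) ≈ 0#
  sumWords-odd k f = trans (sumWords-cong (suc (k ℕ.+ k)) {g = λ _ → 0#} notDyck) (∑-zero (words (suc (k ℕ.+ k))) {f = λ _ → 0#} (λ _ → refl))
    where
    notDyck : ∀ w → length w ≡ suc (k ℕ.+ k) → [ isDyckFrom 0 w ] f w ≈ 0#
    notDyck w ∣w∣≡odd rewrite oddLength⇒notDyck k w ∣w∣≡odd = refl

  [_]-∑ : ∀ {X : Set} b (xs : List X) (f : X → Carrier) → [ b ] ∑ xs f ≈ ∑ xs (λ x → [ b ] f x)
  [ true  ]-∑ xs f = refl
  [ false ]-∑ xs f = sym (∑-zero xs (λ _ → refl))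

  sumDyck-firstReturn : ∀ n g →
    sumDyck (suc n) g ≈ conv n (λ k l → sumDyck k (λ A → sumDyck l (λ B → g (N ∷ A ++ E ∷ B))))
  sumDyck-firstReturn n g = begin
    sumDyck (suc n) g
      ≈⟨ sumDyck-sumWords (suc n) g ⟩
    sumWords (suc (n ℕ.+ suc n)) (λ w → [ isDyckFrom 0 w ] g w)
      ≈⟨ trans (sumWords-suc (n ℕ.+ suc n) _) (∑-cong (words (n ℕ.+ suc n)) (λ w → +-identityʳ _)) ⟩
    sumWords (n ℕ.+ suc n) (λ w → [ isDyckFrom 1 w ] g (N ∷ w))
      ≡⟨ ≡.cong (λ m → sumWords m (λ w → [ isDyckFrom 1 w ] g (N ∷ w))) (+-suc n n) ⟩
    sumWords (suc (n ℕ.+ n)) (λ w → [ isDyckFrom 1 w ] g (N ∷ w))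
      ≈⟨ ∑-cong (words (suc (n ℕ.+ n))) (λ w → firstPassage 0 0 w (g ∘ (N ∷_))) ⟩
    sumWords (suc (n ℕ.+ n)) (splitsSum (λ A B → [ isDyckFrom 0 A ] [ isDyckFrom 0 B ] g (N ∷ A ++ E ∷ B)))
      ≈⟨ sumWords-splitsSum (n ℕ.+ n) _ ⟩
    conv (n ℕ.+ n) (λ k l → sumWords k (λ A → sumWords l (λ B → [ isDyckFrom 0 A ] [ isDyckFrom 0 B ] g (N ∷ A ++ E ∷ B))))
      ≈⟨ conv-cong (n ℕ.+ n) (λ k l _ → ∑-cong (words k) (λ A → sym ([ isDyckFrom 0 A ]-∑ (words l) _))) ⟩
    conv (n ℕ.+ n) (λ k l → sumWords k (λ A → [ isDyckFrom 0 A ] sumWords l (λ B → [ isDyckFrom 0 B ] g (N ∷ A ++ E ∷ B))))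
      ≈⟨ conv-even n (λ k l → sumWords-odd k (λ A → sumWords l (λ B → [ isDyckFrom 0 B ] g (N ∷ A ++ E ∷ B)))) ⟩
    conv n (λ k l → sumWords (k ℕ.+ k) (λ A → [ isDyckFrom 0 A ] sumWords (l ℕ.+ l) (λ B → [ isDyckFrom 0 B ] g (N ∷ A ++ E ∷ B))))
      ≈⟨ conv-cong n (λ k l _ → trans (∑-cong (words (k ℕ.+ k)) (λ A → [ isDyckFrom 0 A ]-cong (sym (sumDyck-sumWords l _))))
                                       (sym (sumDyck-sumWords k _))) ⟩
    conv n (λ k l → sumDyck k (λ A → sumDyck l (λ B → g (N ∷ A ++ E ∷ B))))
      ∎

  1#^≈1# : ∀ n → 1# ^ n ≈ 1#
  1#^≈1# zero    = refl
  1#^≈1# (suc n) = trans (*-identityˡ _) (1#^≈1# n)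

  dyckSum : Carrier → Carrier → Ser
  dyckSum a b n = sumDyck n (λ P → a ^ run n P * b ^ ret P)

  dyckSum₀ : ∀ a b → dyckSum a b 0 ≈ 1#
  dyckSum₀ a b = trans (+-identityʳ _) (*-identityˡ 1#)

  dyckSum-suc : ∀ a b n →
    dyckSum a b (suc n) ≈ a * b * dyckSum a b n + b * ((dyckSum a 1# ⊕ ⊝ 𝟙) ⊛ dyckSum 1# b) n
  dyckSum-suc a b n = begin
    dyckSum a b (suc n)
      ≈⟨ sumDyck-firstReturn n _ ⟩
    conv n (λ k l → sumDyck k (λ A → sumDyck l (λ B → a ^ run (suc n) (N ∷ A ++ E ∷ B) * b ^ ret (N ∷ A ++ E ∷ B))))
      ≈⟨ conv-cong n term ⟩
    conv n (λ k l → T₀ k l + b * (A⁻ k * dyckSum 1# b l))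
      ≈⟨ conv-+ n _ _ ⟩
    conv n T₀ + conv n (λ k l → b * (A⁻ k * dyckSum 1# b l))
      ≈⟨ +-cong (sym (conv-first n {T₀} (λ _ _ → refl))) (conv-*ˡ n b _) ⟨
    a * b * dyckSum a b n + b * (A⁻ ⊛ dyckSum 1# b) n
      ∎
    where
    open import Algebra.Properties.CommutativeSemigroup *-commutativeSemigroup
      using (x∙yz≈y∙xz) renaming (interchange to *-interchange)
    open import Algebra.Properties.Group +-group using (ε⁻¹≈ε)
    A⁻ : Ser
    A⁻ = dyckSum a 1# ⊕ ⊝ 𝟙
    T₀ : ℕ → ℕ → Carrier
    T₀ zero    l = a * b * dyckSum a b l
    T₀ (suc k) l = 0#
    term : ∀ k l → k ℕ.+ l ≡ n →
      sumDyck k (λ A → sumDyck l (λ B → a ^ run (suc n) (N ∷ A ++ E ∷ B) * b ^ ret (N ∷ A ++ E ∷ B)))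
        ≈ T₀ k l + b * (A⁻ k * dyckSum 1# b l)
    term zero l ≡.refl = begin
      sumDyck l (λ B → a ^ run (suc l) (N ∷ E ∷ B) * b ^ ret (N ∷ E ∷ B)) + 0#
        ≈⟨ +-identityʳ _ ⟩
      sumDyck l (λ B → a ^ run (suc l) (N ∷ E ∷ B) * b ^ ret (N ∷ E ∷ B))
        ≈⟨ sumDyck-cong l (λ B B∈𝒟 → trans
             (reflexive (≡.cong₂ (λ r s → a ^ r * b ^ s) (run-NE B B∈𝒟) (ret-firstReturn [] B record { fromGround = ≡.refl ; norths≡ = ≡.refl })))
             (*-interchange a _ b _)) ⟩
      sumDyck l (λ B → a * b * (a ^ run l B * b ^ ret B))
        ≈⟨ ∑-*ˡ (dyck l) (a * b) _ ⟨
      a * b * dyckSum a b l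
        ≈⟨ +-identityʳ _ ⟨
      a * b * dyckSum a b l + 0#
        ≈⟨ +-congˡ (trans (*-congˡ (trans (*-congʳ A⁻₀≈0) (zeroˡ _))) (zeroʳ b)) ⟨
      a * b * dyckSum a b l + b * (A⁻ 0 * dyckSum 1# b l)
        ∎
      where
      A⁻₀≈0 : A⁻ 0 ≈ 0#
      A⁻₀≈0 = trans (+-congʳ (dyckSum₀ a 1#)) (-‿inverseʳ 1#)
    term (suc k) l k+l≡n = begin
      sumDyck (suc k) (λ A → sumDyck l (λ B → a ^ run (suc n) (N ∷ A ++ E ∷ B) * b ^ ret (N ∷ A ++ E ∷ B)))
        ≈⟨ sumDyck-cong (suc k) (λ A A∈𝒟 → sumDyck-cong l (λ B B∈𝒟 → trans
             (reflexive (≡.cong₂ (λ r s → a ^ r * b ^ s) (run-firstReturn A B A∈𝒟 1+k≤n) (ret-firstReturn A B A∈𝒟)))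
             (factor (run (suc k) A) (ret A) (run l B) (ret B)))) ⟩
      sumDyck (suc k) (λ A → sumDyck l (λ B → b * ((a ^ run (suc k) A * 1# ^ ret A) * (1# ^ run l B * b ^ ret B))))
        ≈⟨ sumDyck-cong (suc k) (λ A _ → trans (*-congˡ (∑-*ˡ (dyck l) _ _)) (∑-*ˡ (dyck l) b _)) ⟨
      sumDyck (suc k) (λ A → b * ((a ^ run (suc k) A * 1# ^ ret A) * dyckSum 1# b l))
        ≈⟨ trans (*-congˡ (∑-*ʳ (dyck (suc k)) _ _)) (∑-*ˡ (dyck (suc k)) b _) ⟨
      b * (dyckSum a 1# (suc k) * dyckSum 1# b l)
        ≈⟨ *-congˡ (*-congʳ (trans (+-congˡ ε⁻¹≈ε) (+-identityʳ _))) ⟨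
      b * (A⁻ (suc k) * dyckSum 1# b l)
        ≈⟨ +-identityˡ _ ⟨
      0# + b * (A⁻ (suc k) * dyckSum 1# b l)
        ∎
      where
      1+k≤n : suc k ℕ.≤ n
      1+k≤n = ≡.subst (suc k ℕ.≤_) k+l≡n (m≤m+n (suc k) l)
      factor : ∀ r s u v → a ^ r * b ^ suc v ≈ b * ((a ^ r * 1# ^ s) * (1# ^ u * b ^ v))
      factor r s u v = sym (begin
        b * ((a ^ r * 1# ^ s) * (1# ^ u * b ^ v))
          ≈⟨ *-congˡ (*-cong (trans (*-congˡ (1#^≈1# s)) (*-identityʳ _)) (trans (*-congʳ (1#^≈1# u)) (*-identityˡ _))) ⟩
        b * (a ^ r * b ^ v)                         ≈⟨ x∙yz≈y∙xz b (a ^ r) (b ^ v) ⟩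
        a ^ r * (b * b ^ v)                         ∎)

  dyckSum-equation : ∀ a b → dyckSum a b ≋
    𝟙 ⊕ x ⊛ (monomial 0 (a * b) ⊛ dyckSum a b ⊕ monomial 0 b ⊛ ((dyckSum a 1# ⊕ ⊝ 𝟙) ⊛ dyckSum 1# b))
  dyckSum-equation a b = ≋-constant+x⊛tail 1# _ (dyckSum₀ a b)
    (λ n → trans (dyckSum-suc a b n) (sym (+-cong (monomial₀-⊛ (a * b) _ n) (monomial₀-⊛ b _ n))))

module ClosedForm {c ℓ} (R : CommutativeRing c ℓ)
                  (ι : ℤ.+-*-rawRing -Raw-AlmostCommutative⟶ fromCommutativeRing R) where

  open CommutativeRing R
  open _-Raw-AlmostCommutative⟶_ ι using (⟦_⟧)
  open import Relation.Binary.Reasoning.Setoid setoid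
  open import Algebra.Properties.Group +-group using (x∙y⁻¹≈ε⇒x≈y; x≈y⇒x∙y⁻¹≈ε)

  private
    ι-equal : ∀ m n → Maybe (⟦ m ⟧ ≈ ⟦ n ⟧)
    ι-equal m n with m ℤ.≟ n
    ... | yes ≡.refl = just refl
    ... | no  _      = nothing

  open import Algebra.Solver.Ring ℤ.+-*-rawRing (fromCommutativeRing R) ι ι-equal
    using (solve; _:=_; con; _:+_; _:*_; _:-_; :-_)

  firstReturnRhs : (t a b X Y Z : Carrier) → Carrier
  firstReturnRhs t a b X Y Z = ⟦ + 1 ⟧ + t * (a * b * X + b * ((Y - ⟦ + 1 ⟧) * Z))

  FirstReturnEq : (t a b X Y Z : Carrier) → Set ℓ
  FirstReturnEq t a b X Y Z = X ≈ firstReturnRhs t a b X Y Z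

  catalanSqrt : (t D : Carrier) → Carrier
  catalanSqrt t D = ⟦ + 1 ⟧ - ⟦ + 2 ⟧ * t * D

  -- numer and denom of Defs over an arbitrary ring; at seriesRing they are definitionally equal to them.
  numerator denominator : (p q t S : Carrier) → Carrier
  numerator p q t S =
    ⟦ + 2 ⟧ * p * q * (⟦ + 1 ⟧ - t) - ⟦ + 2 ⟧ * (p + q) + ⟦ + 4 ⟧ + ⟦ + 2 ⟧ * (p + q - p * q - p * q * t) * S
  denominator p q t S = (⟦ + 1 ⟧ - p * q * t) * (⟦ + 2 ⟧ - p + p * S) * (⟦ + 2 ⟧ - q + q * S)

  closedForm : ∀ C A R D p q t S →
    FirstReturnEq t p q C A R → FirstReturnEq t p ⟦ + 1 ⟧ A A D →
    FirstReturnEq t ⟦ + 1 ⟧ q R D R → FirstReturnEq t ⟦ + 1 ⟧ ⟦ + 1 ⟧ D D D →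
    S ≈ catalanSqrt t D →
    C * denominator p q t S ≈ numerator p q t S
  closedForm C A R D p q t S eqC eqA eqR eqD S≈ = begin
    C * denominator p q t S      ≈⟨ *-congˡ (denominator-cong S≈) ⟩
    C * denominator p q t S₀     ≈⟨ certificate ⟩
    numerator p q t S₀ + (eC * kC + eA * kA + eR * kR + eD * kD)
      ≈⟨ +-congˡ (trans (+-cong (+-cong (+-cong (vanish eqC) (vanish eqA)) (vanish eqR)) (vanish eqD)) 0+0+0+0≈0) ⟩
    numerator p q t S₀ + 0#      ≈⟨ +-identityʳ _ ⟩
    numerator p q t S₀           ≈⟨ +-congˡ (*-congˡ S≈) ⟨
    numerator p q t S            ∎
    where
    S₀ eC eA eR eD kC kA kR kD : Carrier
    S₀ = catalanSqrt t D
    eC = C - firstReturnRhs t p q C A R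
    eA = A - firstReturnRhs t p ⟦ + 1 ⟧ A A D
    eR = R - firstReturnRhs t ⟦ + 1 ⟧ q R D R
    eD = D - firstReturnRhs t ⟦ + 1 ⟧ ⟦ + 1 ⟧ D D D
    kC = ⟦ + 4 ⟧ * (⟦ + 1 ⟧ - p * t * D) * (⟦ + 1 ⟧ - q * t * D)
    kA = ⟦ + 4 ⟧ * q * t * D * (⟦ + 1 ⟧ + eR)
    kR = ⟦ + 4 ⟧ * p * q * t * t * D
    kD = ⟦ + 4 ⟧ * (- (p * q * t) - q * t * (A - ⟦ + 1 ⟧) * (⟦ + 1 ⟧ + eR))
    denominator-cong : ∀ {S S′} → S ≈ S′ → denominator p q t S ≈ denominator p q t S′
    denominator-cong S≈S′ = *-cong (*-congˡ (+-congˡ (*-congˡ S≈S′))) (+-congˡ (*-congˡ S≈S′))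
    vanish : ∀ {X Y k} → X ≈ Y → (X - Y) * k ≈ 0#
    vanish X≈Y = trans (*-congʳ (x≈y⇒x∙y⁻¹≈ε X≈Y)) (zeroˡ _)
    0+0+0+0≈0 : 0# + 0# + 0# + 0# ≈ 0#
    0+0+0+0≈0 = trans (+-identityʳ _) (trans (+-identityʳ _) (+-identityʳ _))
    certificate : C * denominator p q t S₀ ≈ numerator p q t S₀ + (eC * kC + eA * kA + eR * kR + eD * kD)
    certificate = solve 7 (λ C A R D p q t →
      let 𝟏 = con (+ 1) ; 𝟐 = con (+ 2) ; 𝟒 = con (+ 4)
          S₀ = 𝟏 :- 𝟐 :* t :* D
          eC = C :- (𝟏 :+ t :* (p :* q :* C :+ q :* ((A :- 𝟏) :* R)))
          eA = A :- (𝟏 :+ t :* (p :* 𝟏 :* A :+ 𝟏 :* ((A :- 𝟏) :* D)))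
          eR = R :- (𝟏 :+ t :* (𝟏 :* q :* R :+ q :* ((D :- 𝟏) :* R)))
          eD = D :- (𝟏 :+ t :* (𝟏 :* 𝟏 :* D :+ 𝟏 :* ((D :- 𝟏) :* D)))
          kC = 𝟒 :* (𝟏 :- p :* t :* D) :* (𝟏 :- q :* t :* D)
          kA = 𝟒 :* q :* t :* D :* (𝟏 :+ eR)
          kR = 𝟒 :* p :* q :* t :* t :* D
          kD = 𝟒 :* (:- (p :* q :* t) :- q :* t :* (A :- 𝟏) :* (𝟏 :+ eR))
      in C :* ((𝟏 :- p :* q :* t) :* (𝟐 :- p :+ p :* S₀) :* (𝟐 :- q :+ q :* S₀))
         := 𝟐 :* p :* q :* (𝟏 :- t) :- 𝟐 :* (p :+ q) :+ 𝟒 :+ 𝟐 :* (p :+ q :- p :* q :- p :* q :* t) :* S₀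
            :+ (eC :* kC :+ eA :* kA :+ eR :* kR :+ eD :* kD)) refl C A R D p q t

  sqrt-factorisation : ∀ t D S → FirstReturnEq t ⟦ + 1 ⟧ ⟦ + 1 ⟧ D D D → S * S ≈ ⟦ + 1 ⟧ - ⟦ + 4 ⟧ * t →
    (S - catalanSqrt t D) * (S + catalanSqrt t D) ≈ 0#
  sqrt-factorisation t D S eqD S²≈ = begin
    (S - T) * (S + T)                                       ≈⟨ certificate ⟩
    (S * S - (⟦ + 1 ⟧ - ⟦ + 4 ⟧ * t)) + ⟦ + 4 ⟧ * t * eD
      ≈⟨ +-cong (x≈y⇒x∙y⁻¹≈ε S²≈) (trans (*-congˡ (x≈y⇒x∙y⁻¹≈ε eqD)) (zeroʳ _)) ⟩
    0# + 0#                                                 ≈⟨ +-identityʳ 0# ⟩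
    0#                                                      ∎
    where
    T eD : Carrier
    T  = catalanSqrt t D
    eD = D - firstReturnRhs t ⟦ + 1 ⟧ ⟦ + 1 ⟧ D D D
    certificate : (S - T) * (S + T) ≈ (S * S - (⟦ + 1 ⟧ - ⟦ + 4 ⟧ * t)) + ⟦ + 4 ⟧ * t * eD
    certificate = solve 3 (λ S t D →
      let 𝟏 = con (+ 1) ; 𝟐 = con (+ 2) ; 𝟒 = con (+ 4)
          T  = 𝟏 :- 𝟐 :* t :* D
          eD = D :- (𝟏 :+ t :* (𝟏 :* 𝟏 :* D :+ 𝟏 :* ((D :- 𝟏) :* D)))
      in (S :- T) :* (S :+ T) := (S :* S :- (𝟏 :- 𝟒 :* t)) :+ 𝟒 :* t :* eD) refl S t D


module _ {c ℓ} (R : CommutativeRing c ℓ) where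
  private
    module R⟦x⟧    = PowerSeries R
    module R⟦x⟧⟦y⟧ = PowerSeries R⟦x⟧.commutativeRing

  conv-pointwise : ∀ n F k → R⟦x⟧⟦y⟧.conv n F k ≡ R⟦x⟧.conv n (λ i j → F i j k)
  conv-pointwise zero    F k = ≡.refl
  conv-pointwise (suc n) F k = ≡.cong (CommutativeRing._+_ R (F 0 (suc n) k)) (conv-pointwise n (λ i j → F (suc i) j) k)

-- Series n a b is the coefficient of tⁿ pᵃ qᵇ, so Series is the carrier of ℤ⟦q⟧⟦p⟧⟦t⟧.
module ℤ⟦q⟧       = PowerSeries ℤ.+-*-commutativeRing
module ℤ⟦q⟧⟦p⟧    = PowerSeries ℤ⟦q⟧.commutativeRing
module ℤ⟦q⟧⟦p⟧⟦t⟧ = PowerSeries ℤ⟦q⟧⟦p⟧.commutativeRing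

open ℤ⟦q⟧⟦p⟧⟦t⟧ using (_⊕_; ⊝_; _⊛_; _≋_; 𝟙)
private
  module ≋ = IsCommutativeRing ℤ⟦q⟧⟦p⟧⟦t⟧.isCommutativeRing

Σ≤≡conv : ∀ n (F : ℕ → ℕ → ℤ) → Σ≤ n (λ i → F i (n ∸ i)) ≡ ℤ⟦q⟧.conv n F
Σ≤≡conv zero    F = ℤ.+-identityʳ (F 0 0)
Σ≤≡conv (suc n) F = ≡.cong (λ z → F 0 (suc n) ℤ.+ z) (≡.trans (≡.cong (foldr ℤ._+_ (+ 0)) shift) (Σ≤≡conv n (λ i j → F (suc i) j)))
  where
  h : ℕ → ℤ
  h i = F i (suc n ∸ i)
  shift : map h (applyUpTo suc (suc n)) ≡ map (λ i → h (suc i)) (applyUpTo (λ i → i) (suc n))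
  shift = ≡.trans (List.map-applyUpTo suc h (suc n)) (≡.sym (List.map-applyUpTo (λ i → i) (λ i → h (suc i)) (suc n)))

*ₛ≋⊛ : ∀ f g → f *ₛ g ≋ f ⊛ g
*ₛ≋⊛ f g n a b = begin
  Σ≤ n (λ i → Σ≤ a (λ j → Σ≤ b (λ k → f i j k ℤ.* g (n ∸ i) (a ∸ j) (b ∸ k))))
    ≡⟨ Σ≤≡conv n _ ⟩
  ℤ⟦q⟧.conv n (λ i i′ → Σ≤ a (λ j → Σ≤ b (λ k → f i j k ℤ.* g i′ (a ∸ j) (b ∸ k))))
    ≡⟨ ℤ⟦q⟧.conv-cong n (λ i i′ _ → ≡.trans (Σ≤≡conv a _) (ℤ⟦q⟧.conv-cong a (λ j j′ _ → Σ≤≡conv b _))) ⟩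
  ℤ⟦q⟧.conv n (λ i i′ → ℤ⟦q⟧.conv a (λ j j′ → ℤ⟦q⟧.conv b (λ k k′ → f i j k ℤ.* g i′ j′ k′)))
    ≡⟨ ℤ⟦q⟧.conv-cong n (λ i i′ _ → conv-pointwise ℤ.+-*-commutativeRing a (λ j j′ → f i j ℤ⟦q⟧.⊛ g i′ j′) b) ⟨
  ℤ⟦q⟧.conv n (λ i i′ → (f i ℤ⟦q⟧⟦p⟧.⊛ g i′) a b)
    ≡⟨ conv-pointwise ℤ.+-*-commutativeRing n (λ i i′ → (f i ℤ⟦q⟧⟦p⟧.⊛ g i′) a) b ⟨
  ℤ⟦q⟧⟦p⟧.conv n (λ i i′ → (f i ℤ⟦q⟧⟦p⟧.⊛ g i′) a) b
    ≡⟨ ≡.cong (λ h → h b) (conv-pointwise ℤ⟦q⟧.commutativeRing n (λ i i′ → f i ℤ⟦q⟧⟦p⟧.⊛ g i′) a) ⟨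
  (f ⊛ g) n a b
    ∎
  where open ≡.≡-Reasoning

mono≋monomial : ∀ c i j k → mono c i j k ≋ ℤ⟦q⟧⟦p⟧⟦t⟧.monomial i (ℤ⟦q⟧⟦p⟧.monomial j (ℤ⟦q⟧.monomial k c))
mono≋monomial c i j k n a b rewrite ℤ⟦q⟧⟦p⟧⟦t⟧.monomial≡if i (ℤ⟦q⟧⟦p⟧.monomial j (ℤ⟦q⟧.monomial k c)) n with n ≡ᵇ i
... | false = ≡.refl
... | true rewrite ℤ⟦q⟧⟦p⟧.monomial≡if j (ℤ⟦q⟧.monomial k c) a with a ≡ᵇ j
...   | false = ≡.refl
...   | true rewrite ℤ⟦q⟧.monomial≡if k c b with b ≡ᵇ k
...     | false = ≡.refl
...     | true  = ≡.refl

1ₛ : Series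
1ₛ = const (+ 1)

1ₛ≋𝟙 : 1ₛ ≋ 𝟙
1ₛ≋𝟙 = mono≋monomial (+ 1) 0 0 0

*ₛ-cong-⊛ : ∀ {f f′ g g′} → f ≋ f′ → g ≋ g′ → f *ₛ g ≋ f′ ⊛ g′
*ₛ-cong-⊛ {f} {f′} {g} {g′} f≋f′ g≋g′ = ≋.trans (*ₛ≋⊛ f g) (ℤ⟦q⟧⟦p⟧⟦t⟧.⊛-cong {f} {f′} {g} {g′} f≋f′ g≋g′)

series-isCommutativeRing : IsCommutativeRing _≈ₛ_ _+ₛ_ _*ₛ_ -ₛ_ ℤ⟦q⟧⟦p⟧⟦t⟧.𝟘 1ₛ
series-isCommutativeRing = record
  { isRing = record
    { +-isAbelianGroup = ≋.+-isAbelianGroup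
    ; *-cong   = λ {f} {f′} {g} {g′} f≋f′ g≋g′ → ≋.trans (*ₛ-cong-⊛ {f} {f′} {g} {g′} f≋f′ g≋g′) (≋.sym (*ₛ≋⊛ f′ g′))
    ; *-assoc  = λ f g h → via⊛ (f *ₛ g) h (≋.trans (ℤ⟦q⟧⟦p⟧⟦t⟧.⊛-cong {f *ₛ g} {f ⊛ g} {h} {h} (*ₛ≋⊛ f g) ≋.refl)
                   (≋.trans (≋.*-assoc f g h) (≋.sym (*ₛ-cong-⊛ {f} {f} {g *ₛ h} {g ⊛ h} ≋.refl (*ₛ≋⊛ g h)))))
    ; *-identity = (λ f → ≋.trans (*ₛ-cong-⊛ {1ₛ} {𝟙} {f} {f} 1ₛ≋𝟙 ≋.refl) (≋.*-identityˡ f))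
                 , (λ f → ≋.trans (*ₛ-cong-⊛ {f} {f} {1ₛ} {𝟙} ≋.refl 1ₛ≋𝟙) (≋.*-identityʳ f))
    ; distrib  = (λ f g h → via⊛ f (g +ₛ h) (≋.trans (≋.distribˡ f g h) (≋.+-cong (≋.sym (*ₛ≋⊛ f g)) (≋.sym (*ₛ≋⊛ f h)))))
               , (λ f g h → via⊛ (g +ₛ h) f (≋.trans (≋.distribʳ f g h) (≋.+-cong (≋.sym (*ₛ≋⊛ g f)) (≋.sym (*ₛ≋⊛ h f)))))
    }
  ; *-comm = λ f g → via⊛ f g (≋.trans (≋.*-comm f g) (≋.sym (*ₛ≋⊛ g f)))
  }
  where
  via⊛ : ∀ f g {h} → f ⊛ g ≋ h → f *ₛ g ≋ h
  via⊛ f g fg≋h = ≋.trans (*ₛ≋⊛ f g) fg≋h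

seriesRing : CommutativeRing _ _
seriesRing = record { isCommutativeRing = series-isCommutativeRing }

const-homomorphism : ℤ.+-*-rawRing -Raw-AlmostCommutative⟶ fromCommutativeRing seriesRing
const-homomorphism = record
  { ⟦_⟧    = const
  ; +-homo = λ x y n a b → if-+ (origin n a b) x y
  ; *-homo = *-homo
  ; -‿homo = λ x n a b → ≡.sym (if-float ℤ.-_ (origin n a b))
  ; 0-homo = λ n a b → if-eta (origin n a b)
  ; 1-homo = λ n a b → ≡.refl
  }
  where
  origin : ℕ → ℕ → ℕ → Bool
  origin n a b = (n ≡ᵇ 0) ∧ (a ≡ᵇ 0) ∧ (b ≡ᵇ 0)
  if-+ : ∀ b x y → (if b then x ℤ.+ y else + 0) ≡ (if b then x else + 0) ℤ.+ (if b then y else + 0)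
  if-+ true  x y = ≡.refl
  if-+ false x y = ≡.refl
  c⟨_⟩ : ℤ → Series
  c⟨ x ⟩ = ℤ⟦q⟧⟦p⟧⟦t⟧.monomial 0 (ℤ⟦q⟧⟦p⟧.monomial 0 (ℤ⟦q⟧.monomial 0 x))
  *-homo : ∀ x y → const (x ℤ.* y) ≋ const x *ₛ const y
  *-homo x y = ≋.sym (begin
    const x *ₛ const y   ≈⟨ *ₛ-cong-⊛ {const x} {c⟨ x ⟩} {const y} {c⟨ y ⟩} (mono≋monomial x 0 0 0) (mono≋monomial y 0 0 0) ⟩
    c⟨ x ⟩ ⊛ c⟨ y ⟩       ≈⟨ ℤ⟦q⟧⟦p⟧⟦t⟧.monomial-* 0 0 _ _ ⟩
    ℤ⟦q⟧⟦p⟧⟦t⟧.monomial 0 (ℤ⟦q⟧⟦p⟧.monomial 0 (ℤ⟦q⟧.monomial 0 x) ℤ⟦q⟧⟦p⟧.⊛ ℤ⟦q⟧⟦p⟧.monomial 0 (ℤ⟦q⟧.monomial 0 y))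
                         ≈⟨ ℤ⟦q⟧⟦p⟧⟦t⟧.monomial-cong 0 (λ a b → ≡.trans (ℤ⟦q⟧⟦p⟧.monomial-* 0 0 _ _ a b)
                                                         (ℤ⟦q⟧⟦p⟧.monomial-cong 0 (ℤ⟦q⟧.monomial-* 0 0 x y) a b)) ⟩
    c⟨ x ℤ.* y ⟩         ≈⟨ mono≋monomial (x ℤ.* y) 0 0 0 ⟨
    const (x ℤ.* y)      ∎)
    where open import Relation.Binary.Reasoning.Setoid (CommutativeRing.setoid ℤ⟦q⟧⟦p⟧⟦t⟧.commutativeRing)

open ClosedForm seriesRing const-homomorphism
open DyckSums ℤ⟦q⟧⟦p⟧.commutativeRing using (dyckSum; dyckSum-equation; ∑; ∑-cong)

p₂ q₂ 1₂ : ℤ⟦q⟧⟦p⟧.Ser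
p₂ = ℤ⟦q⟧⟦p⟧.x
q₂ = ℤ⟦q⟧⟦p⟧.monomial 0 ℤ⟦q⟧.x
-- 𝟙 rather than the projection CommutativeRing.1#, with which comparing types that mention
-- dyckSum 1₂ 1₂ unfolds the sums over Dyck paths and becomes very slow.
1₂ = ℤ⟦q⟧⟦p⟧.𝟙

p₂≋pₛ : ℤ⟦q⟧⟦p⟧⟦t⟧.monomial 0 p₂ ≋ pₛ
p₂≋pₛ = ≋.sym (mono≋monomial (+ 1) 0 1 0)

q₂≋qₛ : ℤ⟦q⟧⟦p⟧⟦t⟧.monomial 0 q₂ ≋ qₛ
q₂≋qₛ = ≋.sym (mono≋monomial (+ 1) 0 0 1)

1₂≋1ₛ : ℤ⟦q⟧⟦p⟧⟦t⟧.monomial 0 1₂ ≋ 1ₛ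
1₂≋1ₛ = ≋.sym 1ₛ≋𝟙

⊛-form⇒FirstReturnEq : ∀ {t α β} t′ ab′ b′ X Y Z → t′ ≋ t → ab′ ≋ α *ₛ β → b′ ≋ β →
  X ≋ 𝟙 ⊕ t′ ⊛ (ab′ ⊛ X ⊕ b′ ⊛ ((Y ⊕ ⊝ 𝟙) ⊛ Z)) → FirstReturnEq t α β X Y Z
⊛-form⇒FirstReturnEq t′ ab′ b′ X Y Z t′≋t ab′≋αβ b′≋β X≋ = ≋.trans X≋ (≋.sym
  (≋.+-cong 1ₛ≋𝟙 (*ₛ-cong-⊛ (≋.sym t′≋t) (≋.+-cong (*ₛ-cong-⊛ (≋.sym ab′≋αβ) (≋.refl {X}))
    (*ₛ-cong-⊛ (≋.sym b′≋β) (*ₛ-cong-⊛ (≋.+-cong (≋.refl {Y}) (≋.-‿cong 1ₛ≋𝟙)) (≋.refl {Z})))))))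

dyckSum-FirstReturnEq : ∀ a b {α β} → ℤ⟦q⟧⟦p⟧⟦t⟧.monomial 0 a ≋ α → ℤ⟦q⟧⟦p⟧⟦t⟧.monomial 0 b ≋ β →
                        FirstReturnEq tₛ α β (dyckSum a b) (dyckSum a 1₂) (dyckSum 1₂ b)
dyckSum-FirstReturnEq a b {α} {β} a≋α b≋β =
  ⊛-form⇒FirstReturnEq {tₛ} {α} {β} ℤ⟦q⟧⟦p⟧⟦t⟧.x (ℤ⟦q⟧⟦p⟧⟦t⟧.monomial 0 (a ℤ⟦q⟧⟦p⟧.⊛ b)) (ℤ⟦q⟧⟦p⟧⟦t⟧.monomial 0 b)
    (dyckSum a b) (dyckSum a 1₂) (dyckSum 1₂ b) (≋.sym (mono≋monomial (+ 1) 1 0 0)) ab≋αβ b≋β (dyckSum-equation a b)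
  where
  ab≋αβ : ℤ⟦q⟧⟦p⟧⟦t⟧.monomial 0 (a ℤ⟦q⟧⟦p⟧.⊛ b) ≋ α *ₛ β
  ab≋αβ = ≋.sym (≋.trans (*ₛ-cong-⊛ (≋.sym a≋α) (≋.sym b≋β)) (ℤ⟦q⟧⟦p⟧⟦t⟧.monomial-* 0 0 a b))

runRet-equation : FirstReturnEq tₛ pₛ qₛ (dyckSum p₂ q₂) (dyckSum p₂ 1₂) (dyckSum 1₂ q₂)
runRet-equation = dyckSum-FirstReturnEq p₂ q₂ p₂≋pₛ q₂≋qₛ

run-equation : FirstReturnEq tₛ pₛ 1ₛ (dyckSum p₂ 1₂) (dyckSum p₂ 1₂) (dyckSum 1₂ 1₂)
run-equation = dyckSum-FirstReturnEq p₂ 1₂ p₂≋pₛ 1₂≋1ₛ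

ret-equation : FirstReturnEq tₛ 1ₛ qₛ (dyckSum 1₂ q₂) (dyckSum 1₂ 1₂) (dyckSum 1₂ q₂)
ret-equation = dyckSum-FirstReturnEq 1₂ q₂ 1₂≋1ₛ q₂≋qₛ

catalan-equation : FirstReturnEq tₛ 1ₛ 1ₛ (dyckSum 1₂ 1₂) (dyckSum 1₂ 1₂) (dyckSum 1₂ 1₂)
catalan-equation = dyckSum-FirstReturnEq 1₂ 1₂ 1₂≋1ₛ 1₂≋1ₛ

p₂^j*q₂^k≋monomial : ∀ j k → p₂ ℤ⟦q⟧⟦p⟧.⊛^ j ℤ⟦q⟧⟦p⟧.⊛ q₂ ℤ⟦q⟧⟦p⟧.⊛^ k ℤ⟦q⟧⟦p⟧.≋ ℤ⟦q⟧⟦p⟧.monomial j (ℤ⟦q⟧.monomial k (+ 1))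
p₂^j*q₂^k≋monomial j k = begin
  p₂ ℤ⟦q⟧⟦p⟧.⊛^ j * q₂ ℤ⟦q⟧⟦p⟧.⊛^ k
    ≈⟨ *-cong (ℤ⟦q⟧⟦p⟧.x⊛^≋monomial j) (ℤ⟦q⟧⟦p⟧.monomial₀-⊛^ ℤ⟦q⟧.x k) ⟩
  ℤ⟦q⟧⟦p⟧.monomial j ℤ⟦q⟧.𝟙 * ℤ⟦q⟧⟦p⟧.monomial 0 (ℤ⟦q⟧.x ℤ⟦q⟧.⊛^ k)
    ≈⟨ *-comm (ℤ⟦q⟧⟦p⟧.monomial j ℤ⟦q⟧.𝟙) _ ⟩
  ℤ⟦q⟧⟦p⟧.monomial 0 (ℤ⟦q⟧.x ℤ⟦q⟧.⊛^ k) * ℤ⟦q⟧⟦p⟧.monomial j ℤ⟦q⟧.𝟙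
    ≈⟨ ℤ⟦q⟧⟦p⟧.monomial-* 0 j (ℤ⟦q⟧.x ℤ⟦q⟧.⊛^ k) ℤ⟦q⟧.𝟙 ⟩
  ℤ⟦q⟧⟦p⟧.monomial j (ℤ⟦q⟧.x ℤ⟦q⟧.⊛^ k ℤ⟦q⟧.⊛ ℤ⟦q⟧.𝟙)
    ≈⟨ ℤ⟦q⟧⟦p⟧.monomial-cong j (λ b → ≡.trans (CommutativeRing.*-identityʳ ℤ⟦q⟧.commutativeRing (ℤ⟦q⟧.x ℤ⟦q⟧.⊛^ k) b)
                                              (ℤ⟦q⟧.x⊛^≋monomial k b)) ⟩
  ℤ⟦q⟧⟦p⟧.monomial j (ℤ⟦q⟧.monomial k (+ 1))
    ∎
  where
  open CommutativeRing ℤ⟦q⟧⟦p⟧.commutativeRing using (setoid; _*_; *-cong; *-comm)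
  open import Relation.Binary.Reasoning.Setoid setoid

monomial²-at : ∀ j k a b →
  ℤ⟦q⟧⟦p⟧.monomial j (ℤ⟦q⟧.monomial k (+ 1)) a b ≡ (if (j ≡ᵇ a) ∧ (k ≡ᵇ b) then + 1 else + 0)
monomial²-at j k a b rewrite ℤ⟦q⟧⟦p⟧.monomial≡if j (ℤ⟦q⟧.monomial k (+ 1)) a | ≡ᵇ-comm a j with j ≡ᵇ a
... | false = ≡.refl
... | true rewrite ℤ⟦q⟧.monomial≡if k (+ 1) b | ≡ᵇ-comm b k = ≡.refl

length-filter-∷ : ∀ {X : Set} (p : X → Bool) x xs →
  + length (filter (λ y → p y ≟ᵇ true) (x ∷ xs)) ≡ (if p x then + 1 else + 0) ℤ.+ + length (filter (λ y → p y ≟ᵇ true) xs)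
length-filter-∷ p x xs with p x
... | true  = ≡.refl
... | false = ≡.sym (ℤ.+-identityˡ _)

count≡∑monomial : ∀ {X : Set} (r s : X → ℕ) (xs : List X) a b →
  + length (filter (λ P → ((r P ≡ᵇ a) ∧ (s P ≡ᵇ b)) ≟ᵇ true) xs) ≡ ∑ xs (λ P → ℤ⟦q⟧⟦p⟧.monomial (r P) (ℤ⟦q⟧.monomial (s P) (+ 1))) a b
count≡∑monomial r s []       a b = ≡.refl
count≡∑monomial r s (x ∷ xs) a b =
  ≡.trans (length-filter-∷ (λ P → (r P ≡ᵇ a) ∧ (s P ≡ᵇ b)) x xs)
          (≡.cong₂ ℤ._+_ (≡.sym (monomial²-at (r x) (s x) a b)) (count≡∑monomial r s xs a b))

C≋dyckSum : C ≋ dyckSum p₂ q₂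
C≋dyckSum n a b = ≡.trans (count≡∑monomial (run n) ret (dyck n) a b)
                          (≡.sym (∑-cong (dyck n) (λ P → p₂^j*q₂^k≋monomial (run n P) (ret P)) a b))

constant≢0⇒⊛-cancelʳ : ∀ {f g} → g 0 0 0 ≢ + 0 → f ⊛ g ≋ ℤ⟦q⟧⟦p⟧⟦t⟧.𝟘 → f ≋ ℤ⟦q⟧⟦p⟧⟦t⟧.𝟘
constant≢0⇒⊛-cancelʳ {f} {g} g₀≢0 = ℤ⟦q⟧⟦p⟧⟦t⟧.⊛-cancelʳ (λ _ → ℤ⟦q⟧⟦p⟧.⊛-cancelʳ (λ _ → ℤ⟦q⟧.⊛-cancelʳ cancel))
  where
  cancel : ∀ c → c ℤ.* g 0 0 0 ≡ + 0 → c ≡ + 0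
  cancel c cg≡0 = [ id , (λ g≡0 → ⊥-elim (g₀≢0 g≡0)) ]′ (ℤ.i*j≡0⇒i≡0∨j≡0 c cg≡0)

-- Both S and catalanSqrt have constant term 1, so S + catalanSqrt has constant term 2 and can be cancelled.
S≈catalanSqrt : ∀ S → S *ₛ S ≈ₛ const (+ 1) -ₛ const (+ 4) *ₛ tₛ → S 0 0 0 ≡ + 1 → S ≈ₛ catalanSqrt tₛ (dyckSum 1₂ 1₂)
S≈catalanSqrt S S²≈1-4t S₀≡1 = x∙y⁻¹≈ε⇒x≈y S T (constant≢0⇒⊛-cancelʳ {S - T} {S +ₛ T} S+T₀≢0
    (≋.trans (≋.sym (*ₛ≋⊛ (S - T) (S +ₛ T))) (sqrt-factorisation tₛ (dyckSum 1₂ 1₂) S catalan-equation S²≈1-4t)))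
  where
  open CommutativeRing seriesRing using (+-group; _-_)
  open import Algebra.Properties.Group +-group using (x∙y⁻¹≈ε⇒x≈y)
  T : Series
  T = catalanSqrt tₛ (dyckSum 1₂ 1₂)
  S+T₀≢0 : S 0 0 0 ℤ.+ + 1 ≢ + 0
  S+T₀≢0 rewrite S₀≡1 = λ ()

theorem4p1 : (S : Series) → S *ₛ S ≈ₛ const (+ 1) -ₛ const (+ 4) *ₛ tₛ → S 0 0 0 ≡ + 1 →
    C *ₛ denom S ≈ₛ numer S
theorem4p1 S S²≈1-4t S₀≡1 = begin
  C *ₛ denom S              ≈⟨ *-congʳ {denom S} {C} {dyckSum p₂ q₂} C≋dyckSum ⟩
  dyckSum p₂ q₂ *ₛ denom S  ≈⟨ closedForm (dyckSum p₂ q₂) (dyckSum p₂ 1₂) (dyckSum 1₂ q₂) (dyckSum 1₂ 1₂) pₛ qₛ tₛ S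
                                 runRet-equation run-equation ret-equation catalan-equation (S≈catalanSqrt S S²≈1-4t S₀≡1) ⟩
  numer S                   ∎
  where
  open CommutativeRing seriesRing using (setoid; *-congʳ)
  open import Relation.Binary.Reasoning.Setoid setoid
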